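{- A Go-diagram is uniquely determined by its shape together with the set of boxes containing white stones. Likewise, a Go-diagram is uniquely determined by its shape together with the set of boxes containing pluses.
   Context: Fix $0<k<n$. A Ferrers shape $\lambda$ is the set of unit boxes Northwest of a lattice path from the Northeast to the Southwest corner of a $k$-row, $(n-k)$-column rectangle; path steps labelled $1,\dots,n$ from the Northeast corner. $b^{in}$ is the set of boxes weakly right of and weakly below $b$. A $\bullet/\circ/+$-diagram fills the boxes with black stones, white stones and pluses. $s_i=(i,i+1)\in\mathfrak S_n$; the top-left box is labelled $s_{n-k}$; the box right of an $s_i$-box is labelled $s_{i-1}$, the box below it $s_{i+1}$; $s_b$ is $b$'s label. A reading order numbers boxes increasing upward and leftward. $u_{b^{in}}$ is the product of $s_c$ over boxes $c\in b^{in}$ containing stones, in increasing reading order (independent of the reading order); $u_b=s_b$ if $b$ contains a stone, else the identity; $\ell$ is Coxeter length. $D$ is a Go-diagram if for every box $b$: $b$ contains a black stone iff $\ell(u_{b^{in}}u_bs_b)<\ell(u_{b^{in}}u_b)$. -}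

module Defs where

open import Data.Nat using (ℕ; zero; suc; _+_; _∸_; _≤_; _<_; _<ᵇ_; _≤ᵇ_)
open import Data.Nat.ListAction using (sum)
open import Data.Bool using (Bool; true; false; if_then_else_; _∧_)
open import Data.Fin using (Fin; zero; suc; toℕ)
open import Data.List using (List; []; _∷_; map; foldr; concatMap; reverse; allFin)
open import Data.Product using (_×_; _,_)
open import Function using (_∘_; id)
open import Relation.Binary.PropositionalEquality using (_≡_)

-- Boxes of the k × m rectangle (m = n - k): row i ∈ Fin k (top row 0),
-- column j ∈ Fin m (left column 0).

record Shape (k m : ℕ) : Set where
  field
    rows       : Fin k → ℕ
    bounded    : ∀ i → rows i ≤ m
    decreasing : ∀ (i i′ : Fin k) → toℕ i ≤ toℕ i′ → rows i′ ≤ rows i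
open Shape public

inShape : ∀ {k m} → Shape k m → Fin k → Fin m → Set
inShape λs i j = toℕ j < rows λs i

inShapeᵇ : ∀ {k m} → Shape k m → Fin k → Fin m → Bool
inShapeᵇ λs i j = toℕ j <ᵇ rows λs i

data Fill : Set where
  black white plus : Fill

isStone : Fill → Bool
isStone black = true
isStone white = true
isStone plus  = false

-- A diagram: a filling of the boxes (values outside the shape are ignored).
Diagram : ℕ → ℕ → Set
Diagram k m = Fin k → Fin m → Fill

-- Permutations of {0,…,n-1} as functions; product = composition.
-- swapAdj p exchanges p and p+1 (0-based); identity if out of range.
swapAdj : ∀ {n} → ℕ → Fin n → Fin n
swapAdj {suc (suc n)} zero zero = suc zero
swapAdj {suc (suc n)} zero (suc zero) = zero
swapAdj {suc (suc n)} zero (suc (suc x)) = suc (suc x)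
swapAdj {suc zero} zero zero = zero
swapAdj {suc n} (suc p) zero = zero
swapAdj {suc n} (suc p) (suc x) = suc (swapAdj p x)

-- the simple transposition s_t = (t, t+1), 1 ≤ t ≤ n-1, on {1,…,n}
sgen : ∀ {n} → ℕ → Fin n → Fin n
sgen t = swapAdj (t ∸ 1)

len : ∀ {n} → (Fin n → Fin n) → ℕ
len {n} w = sum (map (λ a → sum (map (λ b →
  if (toℕ a <ᵇ toℕ b) ∧ (toℕ (w b) <ᵇ toℕ (w a)) then 1 else 0)
  (allFin n))) (allFin n))

-- label of box (i , j): top-left box is s_{n-k}, right decreases index,
-- down increases index, so box (i , j) is s_{(n-k)+i-j}.
label : ∀ {k m} → Fin k → Fin m → ℕ
label {k} {m} i j = m + toℕ i ∸ toℕ j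

-- A fixed reading order: rows from bottom to top, each row from right
-- to left (numbers increase upward and leftward).
readingList : ∀ k m → List (Fin k × Fin m)
readingList k m = concatMap (λ i → map (λ j → (i , j)) (reverse (allFin m))) (reverse (allFin k))

-- u_{b^in} for b = (i₀ , j₀): product of s_c over stone boxes c of the
-- shape weakly right of and weakly below b, in increasing reading order.
uIn : ∀ n k → Shape k (n ∸ k) → Diagram k (n ∸ k) → Fin k → Fin (n ∸ k) → Fin n → Fin n
uIn n k λs D i₀ j₀ =
  foldr (λ { (i , j) acc →
      if (toℕ i₀ ≤ᵇ toℕ i) ∧ (toℕ j₀ ≤ᵇ toℕ j) ∧ inShapeᵇ λs i j ∧ isStone (D i j)
      then sgen (label i j) ∘ acc else acc })
    id (readingList k (n ∸ k))

uBox : ∀ n k → Diagram k (n ∸ k) → Fin k → Fin (n ∸ k) → Fin n → Fin n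
uBox n k D i j = if isStone (D i j) then sgen (label i j) else id

IsGo : ∀ n k → Shape k (n ∸ k) → Diagram k (n ∸ k) → Set
IsGo n k λs D = ∀ (i : Fin k) (j : Fin (n ∸ k)) → inShape λs i j →
  (D i j ≡ black → len (uIn n k λs D i j ∘ uBox n k D i j ∘ sgen (label i j)) < len (uIn n k λs D i j ∘ uBox n k D i j))
  × (len (uIn n k λs D i j ∘ uBox n k D i j ∘ sgen (label i j)) < len (uIn n k λs D i j ∘ uBox n k D i j) → D i j ≡ black)

-- Every box after b in
-- reading order lies outside b^in, so the factor s_b of u_{b^in} comes last and is
-- cancelled by u_b: u_{b^in} u_b is the product over the stones strictly inside b^in.
-- Hence whether b is black depends only on where the stones strictly inside b^in are.
-- If two Go-diagrams have the same pluses they have the same stones, hence the same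
-- black stones, hence coincide. If they have the same white stones, induct from the
-- southeast: once they agree strictly inside b^in, b is black in both or in neither,
-- and knowing the white boxes this settles b.
module Submission where

open import Defs
open import Data.Nat using (ℕ; _∸_; _<_)
open import Data.Fin using (Fin)
open import Data.Product using (_×_)
open import Relation.Binary.PropositionalEquality using (_≡_)

open import Data.Nat using (zero; suc; _≤ᵇ_; _<ᵇ_)
open import Data.Nat.ListAction using (sum)
import Data.Nat.Properties as ℕ
open import Data.Bool using (Bool; true; false; if_then_else_; _∧_; T)
open import Data.Bool.Properties using (T-≡)
open import Function.Bundles using (Equivalence)
open import Data.Empty using (⊥-elim)
open import Data.Fin as Fin using (zero; suc; toℕ; _≤_; _>_; _≟_)
import Data.Fin.Properties as Fin
open import Data.Fin.Induction using (>-wellFounded)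
open import Data.List using (List; []; _∷_; map; foldr; reverse; allFin)
open import Data.List.Properties using (map-cong; unfold-reverse)
open import Data.List.Relation.Unary.All as All using (All; []; _∷_)
import Data.List.Relation.Unary.All.Properties as All
open import Data.List.Relation.Unary.Any as Any using (here; there)
import Data.List.Relation.Unary.Any.Properties as Any
open import Data.List.Relation.Unary.AllPairs as AllPairs using (AllPairs; []; _∷_)
import Data.List.Relation.Unary.AllPairs.Properties as AllPairs
open import Data.List.Membership.Propositional using (_∈_)
open import Data.List.Membership.Propositional.Properties using (∈-allFin; ∈-map⁺; ∈-concatMap⁺)
open import Data.Product using (_,_; proj₁; proj₂)
open import Data.Product.Relation.Binary.Lex.Strict using (×-Lex; ×-wellFounded)
open import Data.Sum using (inj₁; inj₂)
open import Function using (_∘_; id; flip)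
open import Induction.WellFounded as WF using (WellFounded; WfRec)
open import Relation.Nullary using (¬_; yes; no; ofʸ)
open import Relation.Binary.PropositionalEquality using (refl; sym; trans; cong; subst₂; _≢_)

All-reverse⁺ : ∀ {A : Set} {P : A → Set} {xs} → All P xs → All P (reverse xs)
All-reverse⁺ {xs = []} [] = []
All-reverse⁺ {xs = x ∷ xs} (px ∷ pxs) rewrite unfold-reverse x xs =
  All.++⁺ (All-reverse⁺ pxs) (px ∷ [])

AllPairs-reverse⁺ : ∀ {A : Set} {R : A → A → Set} {xs} →
                    AllPairs (flip R) xs → AllPairs R (reverse xs)
AllPairs-reverse⁺ {xs = []} [] = []
AllPairs-reverse⁺ {xs = x ∷ xs} (px ∷ pxs) rewrite unfold-reverse x xs =
  AllPairs.++⁺ (AllPairs-reverse⁺ pxs) ([] ∷ []) (All.map (_∷ []) (All-reverse⁺ px))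

reverse-allFin-decreasing : ∀ m → AllPairs (λ (a b : Fin m) → b Fin.< a) (reverse (allFin m))
reverse-allFin-decreasing m = AllPairs-reverse⁺ (AllPairs.tabulate⁺-< id)

T⇒≡true : ∀ {β} → T β → β ≡ true
T⇒≡true = Equivalence.to T-≡

swapAdj-involutive : ∀ {n} p (x : Fin n) → swapAdj p (swapAdj p x) ≡ x
swapAdj-involutive {suc (suc n)} zero zero = refl
swapAdj-involutive {suc (suc n)} zero (suc zero) = refl
swapAdj-involutive {suc (suc n)} zero (suc (suc x)) = refl
swapAdj-involutive {suc zero} zero zero = refl
swapAdj-involutive {suc zero} (suc p) zero = refl
swapAdj-involutive {suc (suc n)} (suc p) zero = refl
swapAdj-involutive {suc (suc n)} (suc p) (suc x) = cong suc (swapAdj-involutive p x)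

len-cong : ∀ {n} {w w′ : Fin n → Fin n} → (∀ x → w x ≡ w′ x) → len w ≡ len w′
len-cong {n} {w} {w′} w≗w′ =
  cong sum (map-cong (λ a → cong sum (map-cong (inversion-cong a) (allFin n))) (allFin n))
  where
  inversion-cong : ∀ a b →
    (if (toℕ a <ᵇ toℕ b) ∧ (toℕ (w b) <ᵇ toℕ (w a)) then 1 else 0)
    ≡ (if (toℕ a <ᵇ toℕ b) ∧ (toℕ (w′ b) <ᵇ toℕ (w′ a)) then 1 else 0)
  inversion-cong a b rewrite w≗w′ a | w≗w′ b = refl

descent-cong : ∀ {n} {w w′ : Fin n → Fin n} → (∀ x → w x ≡ w′ x) →
               ∀ s → len (w ∘ s) < len w → len (w′ ∘ s) < len w′
descent-cong w≗w′ s = subst₂ _<_ (len-cong (w≗w′ ∘ s)) (len-cong w≗w′)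

module Boxes (k m : ℕ) where

  Box : Set
  Box = Fin k × Fin m

  _≼_ : Box → Box → Set
  (i , j) ≼ (i′ , j′) = i ≤ i′ × j ≤ j′

  _≺_ : Box → Box → Set
  b ≺ c = b ≼ c × c ≢ b

  ≺-wellFounded : WellFounded (flip _≺_)
  ≺-wellFounded = WF.Subrelation.wellFounded ≺⇒lex (×-wellFounded >-wellFounded >-wellFounded)
    where
    ≺⇒lex : ∀ {c b} → b ≺ c → ×-Lex _≡_ _>_ _>_ c b
    ≺⇒lex {i′ , j′} {i , j} ((i≤i′ , j≤j′) , c≢b) with i ≟ i′
    ... | yes refl = inj₂ (refl , Fin.≤∧≢⇒< j≤j′ λ { refl → c≢b refl })
    ... | no i≢i′  = inj₁ (Fin.≤∧≢⇒< i≤i′ i≢i′)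

  ∈-readingList : ∀ (b : Box) → b ∈ readingList k m
  ∈-readingList (i , j) = ∈-concatMap⁺ _ (Any.reverse⁺ (Any.map (λ { refl →
    ∈-map⁺ (i ,_) (Any.reverse⁺ (∈-allFin j)) }) (∈-allFin i)))

  readingList-ordered : AllPairs (λ b c → ¬ b ≼ c) (readingList k m)
  readingList-ordered = AllPairs.concat⁺ (All.map⁺ (All.universal (λ _ → row-ordered) _))
    (AllPairs.map⁺ (AllPairs.map rows-ordered (reverse-allFin-decreasing k)))
    where
    row : Fin k → List Box
    row i = map (i ,_) (reverse (allFin m))
    row-ordered : ∀ {i} → AllPairs (λ b c → ¬ b ≼ c) (row i)
    row-ordered = AllPairs.map⁺ (AllPairs.map (λ j′<j (_ , j≤j′) → ℕ.<⇒≱ j′<j j≤j′)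
                                               (reverse-allFin-decreasing m))
    rows-ordered : ∀ {i i′} → i′ Fin.< i → All (λ b → All (λ c → ¬ b ≼ c) (row i′)) (row i)
    rows-ordered i′<i = All.map⁺ (All.universal (λ _ →
      All.map⁺ (All.universal (λ _ (i≤i′ , _) → ℕ.<⇒≱ i′<i i≤i′) _)) _)

Agree : Fill → Fill → Fill → Set
Agree f a a′ = (a ≡ f → a′ ≡ f) × (a′ ≡ f → a ≡ f)

≡-from-black-white : ∀ {a a′} → Agree black a a′ → Agree white a a′ → a ≡ a′
≡-from-black-white {black} b _ = sym (proj₁ b refl)
≡-from-black-white {white} _ w = sym (proj₁ w refl)
≡-from-black-white {plus} {black} b _ = proj₂ b refl
≡-from-black-white {plus} {white} _ w = proj₂ w refl
≡-from-black-white {plus} {plus} _ _ = refl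

≡-from-black-plus : ∀ {a a′} → Agree black a a′ → Agree plus a a′ → a ≡ a′
≡-from-black-plus {black} b _ = sym (proj₁ b refl)
≡-from-black-plus {plus} _ p = sym (proj₁ p refl)
≡-from-black-plus {white} {black} b _ = proj₂ b refl
≡-from-black-plus {white} {plus} _ p = proj₂ p refl
≡-from-black-plus {white} {white} _ _ = refl

isStone-from-plus : ∀ {a a′} → Agree plus a a′ → isStone a ≡ isStone a′
isStone-from-plus {plus} p = cong isStone (sym (proj₁ p refl))
isStone-from-plus {a′ = plus} p = cong isStone (proj₂ p refl)
isStone-from-plus {black} {black} _ = refl
isStone-from-plus {black} {white} _ = refl
isStone-from-plus {white} {black} _ = refl
isStone-from-plus {white} {white} _ = refl

module GoDiagram (n k : ℕ) (λs : Shape k (n ∸ k)) where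

  open Boxes k (n ∸ k)

  StonesAgreeInside : Diagram k (n ∸ k) → Diagram k (n ∸ k) → Box → Set
  StonesAgreeInside D D′ b =
    ∀ i j → b ≺ (i , j) → inShape λs i j → isStone (D i j) ≡ isStone (D′ i j)

  contributes : Diagram k (n ∸ k) → Box → Box → Bool
  contributes D (i₀ , j₀) (i , j) =
    (toℕ i₀ ≤ᵇ toℕ i) ∧ (toℕ j₀ ≤ᵇ toℕ j) ∧ inShapeᵇ λs i j ∧ isStone (D i j)

  stoneProduct : Diagram k (n ∸ k) → Box → List Box → Fin n → Fin n
  stoneProduct D b =
    foldr (λ c w → if contributes D b c then sgen (label (proj₁ c) (proj₂ c)) ∘ w else w) id

  contributes-outside : ∀ D {b c} → ¬ b ≼ c → contributes D b c ≡ false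
  contributes-outside D {i₀ , j₀} {i , j} b⋠c
    with toℕ i₀ ≤ᵇ toℕ i | ℕ.≤ᵇ-reflects-≤ (toℕ i₀) (toℕ i)
  ... | false | _        = refl
  ... | true  | ofʸ i₀≤i with toℕ j₀ ≤ᵇ toℕ j | ℕ.≤ᵇ-reflects-≤ (toℕ j₀) (toℕ j)
  ...   | false | _        = refl
  ...   | true  | ofʸ j₀≤j = ⊥-elim (b⋠c (i₀≤i , j₀≤j))

  contributes-cong : ∀ {D D′ b} → StonesAgreeInside D D′ b →
                     ∀ {c} → c ≢ b → contributes D b c ≡ contributes D′ b c
  contributes-cong {b = i₀ , j₀} agree {i , j} c≢b
    with toℕ i₀ ≤ᵇ toℕ i | ℕ.≤ᵇ-reflects-≤ (toℕ i₀) (toℕ i)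
  ... | false | _        = refl
  ... | true  | ofʸ i₀≤i with toℕ j₀ ≤ᵇ toℕ j | ℕ.≤ᵇ-reflects-≤ (toℕ j₀) (toℕ j)
  ...   | false | _        = refl
  ...   | true  | ofʸ j₀≤j with inShapeᵇ λs i j | ℕ.<ᵇ-reflects-< (toℕ j) (rows λs i)
  ...     | false | _       = refl
  ...     | true  | ofʸ inS = agree i j ((i₀≤i , j₀≤j) , c≢b) inS

  stoneProduct-outside : ∀ D {b L} → All (λ c → ¬ b ≼ c) L → ∀ x → stoneProduct D b L x ≡ x
  stoneProduct-outside D [] x = refl
  stoneProduct-outside D {L = c ∷ _} (b⋠c ∷ b⋠L) x
    rewrite contributes-outside D b⋠c = stoneProduct-outside D b⋠L x

  stoneProduct-cancel : ∀ D {i j L} → inShape λs i j → All (λ c → ¬ (i , j) ≼ c) L →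
                        ∀ x → stoneProduct D (i , j) ((i , j) ∷ L) (uBox n k D i j x) ≡ x
  stoneProduct-cancel D {i} {j} inS b⋠L x
    rewrite T⇒≡true (ℕ.≤⇒≤ᵇ (ℕ.≤-refl {toℕ i}))
          | T⇒≡true (ℕ.≤⇒≤ᵇ (ℕ.≤-refl {toℕ j}))
          | T⇒≡true (ℕ.<⇒<ᵇ inS)
    with isStone (D i j)
  ... | true  = trans (cong (sgen (label i j)) (stoneProduct-outside D b⋠L _)) (swapAdj-involutive _ x)
  ... | false = stoneProduct-outside D b⋠L x

  stoneProduct-cong : ∀ {D D′ i j} → StonesAgreeInside D D′ (i , j) → inShape λs i j →
    ∀ {L} → AllPairs (λ b c → ¬ b ≼ c) L → (i , j) ∈ L →
    ∀ x → stoneProduct D (i , j) L (uBox n k D i j x)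
        ≡ stoneProduct D′ (i , j) L (uBox n k D′ i j x)
  stoneProduct-cong {D} {D′} _ inS (b⋠L ∷ _) (here refl) x =
    trans (stoneProduct-cancel D inS b⋠L x) (sym (stoneProduct-cancel D′ inS b⋠L x))
  stoneProduct-cong {D} {D′} {i} {j} agree inS {c ∷ L} (c⋠L ∷ sorted) (there b∈L) x
    with contributes D (i , j) c | contributes D′ (i , j) c | contributes-cong agree c≢b
    where
    c≢b : c ≢ (i , j)
    c≢b refl = All.lookup c⋠L b∈L (ℕ.≤-refl , ℕ.≤-refl)
  ... | true  | .true  | refl =
    cong (sgen (label (proj₁ c) (proj₂ c))) (stoneProduct-cong agree inS sorted b∈L x)
  ... | false | .false | refl = stoneProduct-cong agree inS sorted b∈L x

  uIn∘uBox-cong : ∀ {D D′ i j} → StonesAgreeInside D D′ (i , j) → inShape λs i j →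
    ∀ x → uIn n k λs D i j (uBox n k D i j x) ≡ uIn n k λs D′ i j (uBox n k D′ i j x)
  uIn∘uBox-cong {i = i} {j} agree inS =
    stoneProduct-cong agree inS readingList-ordered (∈-readingList (i , j))

  black-cong : ∀ {D D′} → IsGo n k λs D → IsGo n k λs D′ →
    ∀ {i j} → StonesAgreeInside D D′ (i , j) → inShape λs i j → Agree black (D i j) (D′ i j)
  black-cong goD goD′ {i} {j} agree inS =
      proj₂ (goD′ i j inS) ∘ descent-cong (uIn∘uBox-cong agree inS) _ ∘ proj₁ (goD i j inS)
    , proj₂ (goD i j inS) ∘ descent-cong (sym ∘ uIn∘uBox-cong agree inS) _ ∘ proj₁ (goD′ i j inS)

  module _ {D D′ : Diagram k (n ∸ k)} (goD : IsGo n k λs D) (goD′ : IsGo n k λs D′) where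

    determined-by-white : (∀ i j → inShape λs i j → Agree white (D i j) (D′ i j)) →
                          ∀ i j → inShape λs i j → D i j ≡ D′ i j
    determined-by-white sameWhite i j = WF.All.wfRec ≺-wellFounded _ SameIfInShape step (i , j)
      where
      SameIfInShape : Box → Set
      SameIfInShape (i , j) = inShape λs i j → D i j ≡ D′ i j
      step : ∀ b → WfRec (flip _≺_) SameIfInShape b → SameIfInShape b
      step (i , j) sameInside inS = ≡-from-black-white
        (black-cong goD goD′ (λ i′ j′ b≺c inS′ → cong isStone (sameInside b≺c inS′)) inS)
        (sameWhite i j inS)

    determined-by-plus : (∀ i j → inShape λs i j → Agree plus (D i j) (D′ i j)) →
                         ∀ i j → inShape λs i j → D i j ≡ D′ i j
    determined-by-plus samePlus i j inS = ≡-from-black-plus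
      (black-cong goD goD′ (λ i′ j′ _ inS′ → isStone-from-plus (samePlus i′ j′ inS′)) inS)
      (samePlus i j inS)

mainTheorem10 : ∀ (n k : ℕ) → 0 < k → k < n →
    (λs : Shape k (n ∸ k)) (D D′ : Diagram k (n ∸ k)) →
    IsGo n k λs D → IsGo n k λs D′ →
    ((∀ (i : Fin k) (j : Fin (n ∸ k)) → inShape λs i j →
        (D i j ≡ white → D′ i j ≡ white) × (D′ i j ≡ white → D i j ≡ white)) →
      ∀ (i : Fin k) (j : Fin (n ∸ k)) → inShape λs i j → D i j ≡ D′ i j)
    × ((∀ (i : Fin k) (j : Fin (n ∸ k)) → inShape λs i j →
        (D i j ≡ plus → D′ i j ≡ plus) × (D′ i j ≡ plus → D i j ≡ plus)) →
      ∀ (i : Fin k) (j : Fin (n ∸ k)) → inShape λs i j → D i j ≡ D′ i j)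
mainTheorem10 n k _ _ λs D D′ goD goD′ =
  determined-by-white goD goD′ , determined-by-plus goD goD′
  where open GoDiagram n k λs
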